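{- Let $p$ and $r$ be distinct prime numbers. Let $U\in\mathbb{Q}[X]$ be the unique polynomial of degree less than $r-1$ such that $\Phi_pU+\Phi_rV=1$ for some $V\in\mathbb{Q}[X]$, and write $\widetilde U=(X-1)U=\sum_{i=1}^{r}\widetilde u_iX^{i-1}$. Then $\widetilde u_i\in\{ -1,0,1\}$ for every $1\leqslant i\leqslant r$.
   Context: For a positive integer $k$, $\Phi_k\in\mathbb{Z}[X]$ denotes the $k$-th cyclotomic polynomial; for a prime $\ell$, $\Phi_\ell=1+X+\cdots+X^{\ell-1}$. For distinct primes $p,r$ the polynomials $\Phi_p$ and $\Phi_r$ are coprime in $\mathbb{Q}[X]$. -}

module Defs where

open import Data.Nat using (ℕ; zero; suc; _≤_)
open import Relation.Binary.PropositionalEquality using (_≡_)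
open import Data.List using (List; []; _∷_; map; replicate)
open import Data.Rational using (ℚ; 0ℚ; 1ℚ; _+_; _*_; -_)

-- Polynomials in ℚ[X] as coefficient lists, lowest degree first:
-- a₀ ∷ a₁ ∷ … represents a₀ + a₁ X + …  (trailing zeros allowed).
Poly : Set
Poly = List ℚ

coeff : Poly → ℕ → ℚ
coeff []       _       = 0ℚ
coeff (a ∷ _)  zero    = a
coeff (_ ∷ p)  (suc n) = coeff p n

infixl 6 _+ₚ_
infixl 7 _*ₚ_

_+ₚ_ : Poly → Poly → Poly
[]      +ₚ q       = q
(a ∷ p) +ₚ []      = a ∷ p
(a ∷ p) +ₚ (b ∷ q) = (a + b) ∷ (p +ₚ q)

_*ₚ_ : Poly → Poly → Poly
[]      *ₚ q = []
(a ∷ p) *ₚ q = map (a *_) q +ₚ (0ℚ ∷ (p *ₚ q))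

-- equality of polynomials (coefficientwise, so trailing zeros are irrelevant)
infix 4 _≈ₚ_
_≈ₚ_ : Poly → Poly → Set
p ≈ₚ q = ∀ n → coeff p n ≡ coeff q n

DegLt : Poly → ℕ → Set
DegLt p d = ∀ n → d ≤ n → coeff p n ≡ 0ℚ

oneₚ : Poly
oneₚ = 1ℚ ∷ []

X-1 : Poly
X-1 = (- 1ℚ) ∷ 1ℚ ∷ []

-- Φ_ℓ = 1 + X + … + X^(ℓ-1)  (the ℓ-th cyclotomic polynomial for ℓ prime)
Φ : ℕ → Poly
Φ ℓ = replicate ℓ 1ℚ

module Submission where

-- Let p ≠ r be primes and Φ_p U + Φ_r V = 1 with deg U < r − 1.  The
-- coefficients of (X − 1)U are read off in ℚ[X]/(X^r − 1), whose elements
-- we view as r-periodic functions ℤ → ℚ: a polynomial f becomes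
-- ρ f x = Σ_j [x ≡ j (mod r)] f_j.  Multiplication by Φ_m turns a function b
-- into the window sum x ↦ Σ_{k<m} b (x − k), and [x ≡ 0 (mod r)] is the image
-- of 1.  Writing a = ρ U and b = ρ V, the Bézout identity becomes
--   Σ_{k<p} a (x − k) + Σ_{k<r} b (x − k) = [x ≡ 0 (mod r)];
-- the second sum runs over a full period of b, hence is constant, and taking
-- differences in x gives  a x − a (x − p) = [x ≡ 0] − [x ≡ 1].  Choosing
-- q ≤ r with q p ≡ 1 (mod r) and telescoping q times yields
--   a (x − 1) − a x = C (x − 1) − C x,   C y = Σ_{k<q} [y ≡ k p (mod r)],
-- and C y ∈ {0,1} because k ↦ k p is injective modulo r for k < r.  Since
-- deg U < r − 1, the value a n is the coefficient U_n for 0 ≤ n < r and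
-- a (−1) = 0, so the n-th coefficient of (X − 1)U is a (n − 1) − a n.

open import Defs
open import Data.Nat using (ℕ; zero; suc; _≤_; _<_; _∸_; _+_; _*_; NonZero)
open import Data.Nat.Primality using (Prime; prime⇒irreducible; ¬prime[0]; ¬prime[1])
open import Data.Nat.Coprimality using (Coprime; coprime-Bézout; coprime-divisor) renaming (sym to coprime-sym)
open import Data.Nat.GCD using (module Bézout)
open import Data.Nat.DivMod using (_%_; _/_; m≡m%n+[m/n]*n; m%n<n)
open import Data.Nat.Divisibility using (_∣_; _∣0; ∣⇒≤; n∣m*n; m∣m*n; ∣m∣n⇒∣m+n)
open import Data.Integer using (ℤ; +_; 0ℤ; 1ℤ)
open import Data.Rational using (ℚ; 0ℚ; 1ℚ; -_)
open import Data.List using (map; []; _∷_)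
open import Data.Product using (∃-syntax; _×_; _,_; proj₁)
open import Data.Sum using (_⊎_; inj₁; inj₂; [_,_]′)
open import Function using (_∘_)
open import Relation.Nullary using (¬_; Dec; yes; no; contradiction)
open import Relation.Nullary.Decidable using (map′)
open import Relation.Binary.PropositionalEquality
  using (_≡_; _≢_; refl; sym; trans; cong; cong₂; subst; module ≡-Reasoning)
import Data.Nat.Properties as NP
import Data.Integer as Z
import Data.Integer.Properties as ZP
import Data.Integer.Divisibility.Signed as ZD
import Data.Rational as Q
import Data.Rational.Properties as QP
open import Data.Rational.Solver using (module +-*-Solver)
open +-*-Solver using (solve; _:+_; _:*_; :-_; _:-_; _:=_; con)
open import Data.Integer.Tactic.RingSolver using (solve-∀)
import Data.Nat.Tactic.RingSolver as NatSolver

open ≡-Reasoning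

coeff-+ : ∀ f g n → coeff (f +ₚ g) n ≡ coeff f n Q.+ coeff g n
coeff-+ []      g       n       = sym (QP.+-identityˡ _)
coeff-+ (a ∷ f) []      n       = sym (QP.+-identityʳ _)
coeff-+ (a ∷ f) (b ∷ g) zero    = refl
coeff-+ (a ∷ f) (b ∷ g) (suc n) = coeff-+ f g n

coeff-map : ∀ c f n → coeff (map (c Q.*_) f) n ≡ c Q.* coeff f n
coeff-map c []      n       = sym (QP.*-zeroʳ c)
coeff-map c (a ∷ f) zero    = refl
coeff-map c (a ∷ f) (suc n) = coeff-map c f n

coeff-X-1*-zero : ∀ U → coeff (X-1 *ₚ U) 0 ≡ 0ℚ Q.- coeff U 0
coeff-X-1*-zero U = begin
    coeff (X-1 *ₚ U) 0
  ≡⟨ coeff-+ (map ((- 1ℚ) Q.*_) U) _ 0 ⟩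
    coeff (map ((- 1ℚ) Q.*_) U) 0 Q.+ 0ℚ
  ≡⟨ cong (Q._+ 0ℚ) (coeff-map (- 1ℚ) U 0) ⟩
    (- 1ℚ) Q.* coeff U 0 Q.+ 0ℚ
  ≡⟨ solve 1 (λ u → :- con 1ℚ :* u :+ con 0ℚ := con 0ℚ :- u) refl (coeff U 0) ⟩
    0ℚ Q.- coeff U 0 ∎

coeff-X-1*-suc : ∀ U m → coeff (X-1 *ₚ U) (suc m) ≡ coeff U m Q.- coeff U (suc m)
coeff-X-1*-suc U m = begin
    coeff (X-1 *ₚ U) (suc m)
  ≡⟨ coeff-+ (map ((- 1ℚ) Q.*_) U) _ (suc m) ⟩
    coeff (map ((- 1ℚ) Q.*_) U) (suc m) Q.+ coeff (map (1ℚ Q.*_) U +ₚ (0ℚ ∷ [])) m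
  ≡⟨ cong₂ Q._+_ (coeff-map (- 1ℚ) U (suc m)) shifted-copy ⟩
    (- 1ℚ) Q.* coeff U (suc m) Q.+ (1ℚ Q.* coeff U m Q.+ 0ℚ)
  ≡⟨ solve 2 (λ u v → :- con 1ℚ :* u :+ (con 1ℚ :* v :+ con 0ℚ) := v :- u) refl
       (coeff U (suc m)) (coeff U m) ⟩
    coeff U m Q.- coeff U (suc m) ∎
  where
  coeff-zero : ∀ k → coeff (0ℚ ∷ []) k ≡ 0ℚ
  coeff-zero zero    = refl
  coeff-zero (suc k) = refl

  shifted-copy : coeff (map (1ℚ Q.*_) U +ₚ (0ℚ ∷ [])) m ≡ 1ℚ Q.* coeff U m Q.+ 0ℚ
  shifted-copy = trans (coeff-+ (map (1ℚ Q.*_) U) (0ℚ ∷ []) m)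
                       (cong₂ Q._+_ (coeff-map 1ℚ U m) (coeff-zero m))

sumBelow : ℕ → (ℕ → ℚ) → ℚ
sumBelow zero    h = 0ℚ
sumBelow (suc m) h = h 0 Q.+ sumBelow m (h ∘ suc)

sum-cong : ∀ m {h h′} → (∀ k → h k ≡ h′ k) → sumBelow m h ≡ sumBelow m h′
sum-cong zero    e = refl
sum-cong (suc m) e = cong₂ Q._+_ (e 0) (sum-cong m (e ∘ suc))

sum-snoc : ∀ m h → sumBelow (suc m) h ≡ sumBelow m h Q.+ h m
sum-snoc zero    h = trans (QP.+-identityʳ (h 0)) (sym (QP.+-identityˡ (h 0)))
sum-snoc (suc m) h = begin
    h 0 Q.+ sumBelow (suc m) (h ∘ suc)
  ≡⟨ cong (h 0 Q.+_) (sum-snoc m (h ∘ suc)) ⟩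
    h 0 Q.+ (sumBelow m (h ∘ suc) Q.+ h (suc m))
  ≡⟨ sym (QP.+-assoc (h 0) _ _) ⟩
    (h 0 Q.+ sumBelow m (h ∘ suc)) Q.+ h (suc m) ∎

sum-sub : ∀ m f g → sumBelow m (λ k → f k Q.- g k) ≡ sumBelow m f Q.- sumBelow m g
sum-sub zero    f g = refl
sum-sub (suc m) f g = begin
    (f 0 Q.- g 0) Q.+ sumBelow m (λ k → f (suc k) Q.- g (suc k))
  ≡⟨ cong ((f 0 Q.- g 0) Q.+_) (sum-sub m (f ∘ suc) (g ∘ suc)) ⟩
    (f 0 Q.- g 0) Q.+ (sumBelow m (f ∘ suc) Q.- sumBelow m (g ∘ suc))
  ≡⟨ solve 4 (λ a b c d → (a :- b) :+ (c :- d) := (a :+ c) :- (b :+ d)) refl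
       (f 0) (g 0) (sumBelow m (f ∘ suc)) (sumBelow m (g ∘ suc)) ⟩
    (f 0 Q.+ sumBelow m (f ∘ suc)) Q.- (g 0 Q.+ sumBelow m (g ∘ suc)) ∎

sub≡0⇒≡ : ∀ u v → u Q.- v ≡ 0ℚ → u ≡ v
sub≡0⇒≡ u v h = begin
  u               ≡⟨ solve 2 (λ u v → u := (u :- v) :+ v) refl u v ⟩
  (u Q.- v) Q.+ v ≡⟨ cong (Q._+ v) h ⟩
  0ℚ Q.+ v        ≡⟨ QP.+-identityˡ v ⟩
  v               ∎

sub-suc : ∀ x w → x Z.- (1ℤ Z.+ w) ≡ (x Z.- 1ℤ) Z.- w
sub-suc = solve-∀

-- windowSum b m x = b x + b (x − 1) + … + b (x − m + 1); this is the effect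
-- of multiplying by Φ_m = 1 + X + … + X^(m−1) on functions ℤ → ℚ.
windowSum : (ℤ → ℚ) → ℕ → ℤ → ℚ
windowSum b m x = sumBelow m (λ k → b (x Z.- + k))

windowSum-diff : ∀ b m x →
  windowSum b m x Q.- windowSum b m (x Z.- 1ℤ) ≡ b x Q.- b (x Z.- + m)
windowSum-diff b zero x =
  trans (QP.+-inverseʳ 0ℚ) (sym (trans (cong (λ w → b x Q.- b w) (ZP.+-identityʳ x)) (QP.+-inverseʳ (b x))))
windowSum-diff b (suc m) x = begin
    windowSum b (suc m) x Q.- windowSum b (suc m) (x Z.- 1ℤ)
  ≡⟨ cong₂ Q._-_ (cong₂ Q._+_ (cong b (ZP.+-identityʳ x)) (sum-cong m (λ k → cong b (sub-suc x (+ k)))))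
                 (sum-snoc m _) ⟩
    (b x Q.+ T) Q.- (T Q.+ b ((x Z.- 1ℤ) Z.- + m))
  ≡⟨ solve 3 (λ u t v → (u :+ t) :- (t :+ v) := u :- v) refl (b x) T _ ⟩
    b x Q.- b ((x Z.- 1ℤ) Z.- + m)
  ≡⟨ cong (λ w → b x Q.- b w) (sym (sub-suc x (+ m))) ⟩
    b x Q.- b (x Z.- + suc m) ∎
  where T = sumBelow m (λ k → b ((x Z.- 1ℤ) Z.- + k))

windowSum-periodic : ∀ b m → (∀ x → b (x Z.- + m) ≡ b x) →
  ∀ x → windowSum b m x ≡ windowSum b m (x Z.- 1ℤ)
windowSum-periodic b m per x = sub≡0⇒≡ _ _ (begin
  windowSum b m x Q.- windowSum b m (x Z.- 1ℤ) ≡⟨ windowSum-diff b m x ⟩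
  b x Q.- b (x Z.- + m)                         ≡⟨ cong (λ w → b x Q.- w) (per x) ⟩
  b x Q.- b x                                   ≡⟨ QP.+-inverseʳ (b x) ⟩
  0ℚ                                            ∎)

telescope : ∀ (a d : ℤ → ℚ) s → (∀ x → a x Q.- a (x Z.- + s) ≡ d x) →
  ∀ x q → a x Q.- a (x Z.- + (q * s)) ≡ sumBelow q (λ k → d (x Z.- + (k * s)))
telescope a d s step x zero = trans (cong (λ w → a x Q.- a w) (ZP.+-identityʳ x)) (QP.+-inverseʳ (a x))
telescope a d s step x (suc q) = begin
    a x Q.- a (x Z.- + (suc q * s))
  ≡⟨ cong (λ w → a x Q.- a w) (split x (+ s) (+ (q * s))) ⟩
    a x Q.- a (y Z.- + s)
  ≡⟨ solve 3 (λ u v w → u :- w := (u :- v) :+ (v :- w)) refl (a x) (a y) (a (y Z.- + s)) ⟩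
    (a x Q.- a y) Q.+ (a y Q.- a (y Z.- + s))
  ≡⟨ cong₂ Q._+_ (telescope a d s step x q) (step y) ⟩
    sumBelow q (λ k → d (x Z.- + (k * s))) Q.+ d y
  ≡⟨ sym (sum-snoc q (λ k → d (x Z.- + (k * s)))) ⟩
    sumBelow (suc q) (λ k → d (x Z.- + (k * s))) ∎
  where
  y = x Z.- + (q * s)
  split : ∀ x u v → x Z.- (u Z.+ v) ≡ (x Z.- v) Z.- u
  split = solve-∀

𝟙 : {P : Set} → Dec P → ℚ
𝟙 (yes _) = 1ℚ
𝟙 (no _)  = 0ℚ

𝟙-yes : {P : Set} (d : Dec P) → P → 𝟙 d ≡ 1ℚ
𝟙-yes (yes _) _  = refl
𝟙-yes (no ¬p) p = contradiction p ¬p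

𝟙-no : {P : Set} (d : Dec P) → ¬ P → 𝟙 d ≡ 0ℚ
𝟙-no (yes p) ¬p = contradiction p ¬p
𝟙-no (no _)  _  = refl

𝟙-cong : {P R : Set} → (P → R) → (R → P) → (d : Dec P) (e : Dec R) → 𝟙 d ≡ 𝟙 e
𝟙-cong f g (yes p) e = sym (𝟙-yes e (f p))
𝟙-cong f g (no ¬p) e = sym (𝟙-no e (¬p ∘ g))

Bit : ℚ → Set
Bit c = c ≡ 0ℚ ⊎ c ≡ 1ℚ

Sign : ℚ → Set
Sign c = c ≡ - 1ℚ ⊎ c ≡ 0ℚ ⊎ c ≡ 1ℚ

bit-difference : ∀ {u v} → Bit u → Bit v → Sign (u Q.- v)
bit-difference (inj₁ refl) (inj₁ refl) = inj₂ (inj₁ refl)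
bit-difference (inj₁ refl) (inj₂ refl) = inj₁ refl
bit-difference (inj₂ refl) (inj₁ refl) = inj₂ (inj₂ refl)
bit-difference (inj₂ refl) (inj₂ refl) = inj₂ (inj₁ refl)

AtMostOnce : (ℕ → Set) → ℕ → Set
AtMostOnce P q = ∀ {k l} → k < q → l < q → P k → P l → k ≡ l

-- Counting a predicate that holds at most once below q: the count is 0, or
-- it is 1 and the predicate holds somewhere below q (the witness drives the
-- induction).
indicator-sum-count : ∀ {P : ℕ → Set} (P? : ∀ k → Dec (P k)) q → AtMostOnce P q →
  sumBelow q (λ k → 𝟙 (P? k)) ≡ 0ℚ ⊎
  (sumBelow q (λ k → 𝟙 (P? k)) ≡ 1ℚ × ∃[ k ] (k < q × P k))
indicator-sum-count P? zero    _    = inj₁ refl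
indicator-sum-count P? (suc q) once rewrite sum-snoc q (λ k → 𝟙 (P? k))
  with indicator-sum-count P? q (λ k< l< → once (NP.m<n⇒m<1+n k<) (NP.m<n⇒m<1+n l<)) | P? q
... | inj₁ e                  | yes Pq = inj₂ (cong (Q._+ 1ℚ) e , q , NP.n<1+n q , Pq)
... | inj₁ e                  | no _   = inj₁ (cong (Q._+ 0ℚ) e)
... | inj₂ (e , k , k<q , Pk) | yes Pq =
  contradiction (once (NP.m<n⇒m<1+n k<q) (NP.n<1+n q) Pk Pq) (NP.<⇒≢ k<q)
... | inj₂ (e , k , k<q , Pk) | no _   = inj₂ (cong (Q._+ 0ℚ) e , k , NP.m<n⇒m<1+n k<q , Pk)

indicator-sum-bit : ∀ {P : ℕ → Set} (P? : ∀ k → Dec (P k)) q →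
  AtMostOnce P q → Bit (sumBelow q (λ k → 𝟙 (P? k)))
indicator-sum-bit P? q once = [ inj₁ , inj₂ ∘ proj₁ ]′ (indicator-sum-count P? q once)

small-multiple : ∀ {r m} → m < r → r ∣ m → m ≡ 0
small-multiple {m = zero}  _   _   = refl
small-multiple {m = suc m} m<r r∣m = contradiction (∣⇒≤ r∣m) (NP.<⇒≱ m<r)

∣∸-both⇒≡ : ∀ {r m n} → m < r → n < r → r ∣ m ∸ n → r ∣ n ∸ m → m ≡ n
∣∸-both⇒≡ {m = m} {n} m<r n<r r∣m∸n r∣n∸m = NP.≤-antisym
  (NP.m∸n≡0⇒m≤n (small-multiple (NP.≤-<-trans (NP.m∸n≤m m n) m<r) r∣m∸n))
  (NP.m∸n≡0⇒m≤n (small-multiple (NP.≤-<-trans (NP.m∸n≤m n m) n<r) r∣n∸m))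

distinct-primes-coprime : ∀ {p r} → Prime p → Prime r → p ≢ r → Coprime p r
distinct-primes-coprime pp pr p≢r {d} (d∣p , d∣r) with prime⇒irreducible pp d∣p
... | inj₁ d≡1 = d≡1
... | inj₂ refl with prime⇒irreducible pr d∣r
...   | inj₁ p≡1 = contradiction (subst Prime p≡1 pp) ¬prime[1]
...   | inj₂ p≡r = contradiction p≡r p≢r

module Modulo (r : ℕ) where

  infix 4 _≋_ _≋?_

  record _≋_ (x y : ℤ) : Set where
    constructor mod-r
    field divides-difference : + r ZD.∣ x Z.- y
  open _≋_

  _≋?_ : ∀ x y → Dec (x ≋ y)
  x ≋? y = map′ mod-r divides-difference (+ r ZD.∣? x Z.- y)

  ≋-from : ∀ {d x y} → + r ZD.∣ d → d ≡ x Z.- y → x ≋ y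
  ≋-from r∣d d≡x-y = mod-r (subst (+ r ZD.∣_) d≡x-y r∣d)

  ≋-refl : ∀ {x} → x ≋ x
  ≋-refl {x} = mod-r (ZD.divides 0ℤ (ZP.+-inverseʳ x))

  ≋-sym : ∀ {x y} → x ≋ y → y ≋ x
  ≋-sym {x} {y} h = ≋-from (ZD.∣m⇒∣-m (divides-difference h)) (flip x y)
    where
    flip : ∀ x y → Z.- (x Z.- y) ≡ y Z.- x
    flip = solve-∀

  ≋-trans : ∀ {x y z} → x ≋ y → y ≋ z → x ≋ z
  ≋-trans {x} {y} {z} h k =
    ≋-from (ZD.∣m∣n⇒∣m+n (divides-difference h) (divides-difference k)) (chain x y z)
    where
    chain : ∀ x y z → (x Z.- y) Z.+ (y Z.- z) ≡ x Z.- z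
    chain = solve-∀

  ≋-shift : ∀ {x y} c → x ≋ y → x Z.- c ≋ y Z.- c
  ≋-shift {x} {y} c h = ≋-from (divides-difference h) (shifted x y c)
    where
    shifted : ∀ x y c → x Z.- y ≡ (x Z.- c) Z.- (y Z.- c)
    shifted = solve-∀

  ≋-sub-left : ∀ {a b} y → a ≋ b → y Z.- a ≋ y Z.- b
  ≋-sub-left {a} {b} y h = ≋-from (ZD.∣m⇒∣-m (divides-difference h)) (negated y a b)
    where
    negated : ∀ y a b → Z.- (a Z.- b) ≡ (y Z.- a) Z.- (y Z.- b)
    negated = solve-∀

  ≋-cancel-left : ∀ {a b} y → y Z.- a ≋ y Z.- b → a ≋ b
  ≋-cancel-left {a} {b} y h = ≋-from (ZD.∣m⇒∣-m (divides-difference h)) (cancelled y a b)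
    where
    cancelled : ∀ y a b → Z.- ((y Z.- a) Z.- (y Z.- b)) ≡ a Z.- b
    cancelled = solve-∀

  ≋-period : ∀ x → x Z.- + r ≋ x
  ≋-period x = ≋-from (ZD.∣m⇒∣-m ZD.∣-refl) (back x (+ r))
    where
    back : ∀ x s → Z.- s ≡ (x Z.- s) Z.- x
    back = solve-∀

  -- ind x = [x ≡ 0 (mod r)], the residue function of the polynomial 1.
  ind : ℤ → ℚ
  ind x = 𝟙 (x ≋? 0ℤ)

  ind-cong : ∀ {x y} → x ≋ y → ind x ≡ ind y
  ind-cong x≋y = 𝟙-cong (≋-trans (≋-sym x≋y)) (≋-trans x≋y) (_ ≋? 0ℤ) (_ ≋? 0ℤ)

  -- ρ f x = Σ_j [x ≡ j (mod r)] f_j: the coefficient of X^(x mod r) in the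
  -- reduction of f modulo X^r − 1.
  ρ : Poly → ℤ → ℚ
  ρ []      x = 0ℚ
  ρ (c ∷ f) x = ind x Q.* c Q.+ ρ f (x Z.- 1ℤ)

  ρ-periodic : ∀ f {x y} → x ≋ y → ρ f x ≡ ρ f y
  ρ-periodic []      x≋y = refl
  ρ-periodic (c ∷ f) x≋y =
    cong₂ (λ u v → u Q.* c Q.+ v) (ind-cong x≋y) (ρ-periodic f (≋-shift 1ℤ x≋y))

  ¬≋-pred : ∀ {x} j → ¬ x ≋ + suc j → ¬ x Z.- 1ℤ ≋ + j
  ¬≋-pred {x} j ¬h h = ¬h (≋-from (divides-difference h) (sym (sub-suc x (+ j))))

  𝟙-pred : ∀ x n → 𝟙 (x Z.- 1ℤ ≋? + n) ≡ 𝟙 (x ≋? + suc n)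
  𝟙-pred x n = 𝟙-cong (λ h → ≋-from (divides-difference h) (sym (sub-suc x (+ n))))
                      (λ h → ≋-from (divides-difference h) (sub-suc x (+ n)))
                      (x Z.- 1ℤ ≋? + n) (x ≋? + suc n)

  head-vanishes : ∀ x c → c ≡ 0ℚ ⊎ ¬ x ≋ 0ℤ → ind x Q.* c ≡ 0ℚ
  head-vanishes x c (inj₁ c≡0)  = trans (cong (ind x Q.*_) c≡0) (QP.*-zeroʳ (ind x))
  head-vanishes x c (inj₂ ¬x≋0) = trans (cong (Q._* c) (𝟙-no (x ≋? 0ℤ) ¬x≋0)) (QP.*-zeroˡ c)

  ρ-none : ∀ f x → (∀ j → coeff f j ≡ 0ℚ ⊎ ¬ x ≋ + j) → ρ f x ≡ 0ℚ
  ρ-none []      x h = refl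
  ρ-none (c ∷ f) x h = cong₂ Q._+_ (head-vanishes x c (h 0))
    (ρ-none f (x Z.- 1ℤ) (λ j → [ inj₁ , inj₂ ∘ ¬≋-pred j ]′ (h (suc j))))

  ρ-one : ∀ f x n → (∀ j → j ≢ n → coeff f j ≡ 0ℚ ⊎ ¬ x ≋ + j) →
          ρ f x ≡ 𝟙 (x ≋? + n) Q.* coeff f n
  ρ-one []      x n       h = sym (QP.*-zeroʳ (𝟙 (x ≋? + n)))
  ρ-one (c ∷ f) x zero    h = begin
      ind x Q.* c Q.+ ρ f (x Z.- 1ℤ)
    ≡⟨ cong (ind x Q.* c Q.+_) (ρ-none f (x Z.- 1ℤ) tail) ⟩
      ind x Q.* c Q.+ 0ℚ
    ≡⟨ QP.+-identityʳ _ ⟩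
      ind x Q.* c ∎
    where
    tail : ∀ j → coeff f j ≡ 0ℚ ⊎ ¬ x Z.- 1ℤ ≋ + j
    tail j = [ inj₁ , inj₂ ∘ ¬≋-pred j ]′ (h (suc j) λ ())
  ρ-one (c ∷ f) x (suc n) h = begin
      ind x Q.* c Q.+ ρ f (x Z.- 1ℤ)
    ≡⟨ cong₂ Q._+_ (head-vanishes x c (h 0 λ ())) (ρ-one f (x Z.- 1ℤ) n tail) ⟩
      0ℚ Q.+ 𝟙 (x Z.- 1ℤ ≋? + n) Q.* coeff f n
    ≡⟨ QP.+-identityˡ _ ⟩
      𝟙 (x Z.- 1ℤ ≋? + n) Q.* coeff f n
    ≡⟨ cong (Q._* coeff f n) (𝟙-pred x n) ⟩
      𝟙 (x ≋? + suc n) Q.* coeff f n ∎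
    where
    tail : ∀ j → j ≢ n → coeff f j ≡ 0ℚ ⊎ ¬ x Z.- 1ℤ ≋ + j
    tail j j≢n = [ inj₁ , inj₂ ∘ ¬≋-pred j ]′ (h (suc j) (j≢n ∘ NP.suc-injective))

  ρ-resp : ∀ f g → f ≈ₚ g → ∀ x → ρ f x ≡ ρ g x
  ρ-resp []      g       f≈g x = sym (ρ-none g x (λ j → inj₁ (sym (f≈g j))))
  ρ-resp (a ∷ f) []      f≈g x = ρ-none (a ∷ f) x (inj₁ ∘ f≈g)
  ρ-resp (a ∷ f) (b ∷ g) f≈g x =
    cong₂ (λ u v → ind x Q.* u Q.+ v) (f≈g 0) (ρ-resp f g (f≈g ∘ suc) (x Z.- 1ℤ))

  ρ-+ : ∀ f g x → ρ (f +ₚ g) x ≡ ρ f x Q.+ ρ g x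
  ρ-+ []      g       x = sym (QP.+-identityˡ _)
  ρ-+ (a ∷ f) []      x = sym (QP.+-identityʳ _)
  ρ-+ (a ∷ f) (b ∷ g) x = begin
      ind x Q.* (a Q.+ b) Q.+ ρ (f +ₚ g) (x Z.- 1ℤ)
    ≡⟨ cong (ind x Q.* (a Q.+ b) Q.+_) (ρ-+ f g (x Z.- 1ℤ)) ⟩
      ind x Q.* (a Q.+ b) Q.+ (ρ f (x Z.- 1ℤ) Q.+ ρ g (x Z.- 1ℤ))
    ≡⟨ solve 5 (λ i a b u v → i :* (a :+ b) :+ (u :+ v) := (i :* a :+ u) :+ (i :* b :+ v)) refl
         (ind x) a b (ρ f (x Z.- 1ℤ)) (ρ g (x Z.- 1ℤ)) ⟩
      (ind x Q.* a Q.+ ρ f (x Z.- 1ℤ)) Q.+ (ind x Q.* b Q.+ ρ g (x Z.- 1ℤ)) ∎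

  ρ-scale : ∀ c f x → ρ (map (c Q.*_) f) x ≡ c Q.* ρ f x
  ρ-scale c []      x = sym (QP.*-zeroʳ c)
  ρ-scale c (a ∷ f) x = begin
      ind x Q.* (c Q.* a) Q.+ ρ (map (c Q.*_) f) (x Z.- 1ℤ)
    ≡⟨ cong (ind x Q.* (c Q.* a) Q.+_) (ρ-scale c f (x Z.- 1ℤ)) ⟩
      ind x Q.* (c Q.* a) Q.+ c Q.* ρ f (x Z.- 1ℤ)
    ≡⟨ solve 4 (λ i c a u → i :* (c :* a) :+ c :* u := c :* (i :* a :+ u)) refl
         (ind x) c a (ρ f (x Z.- 1ℤ)) ⟩
      c Q.* (ind x Q.* a Q.+ ρ f (x Z.- 1ℤ)) ∎

  ρ-shift : ∀ g x → ρ (0ℚ ∷ g) x ≡ ρ g (x Z.- 1ℤ)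
  ρ-shift g x = trans (cong (Q._+ ρ g (x Z.- 1ℤ)) (QP.*-zeroʳ (ind x))) (QP.+-identityˡ _)

  ρ-Φ* : ∀ m g x → ρ (Φ m *ₚ g) x ≡ windowSum (ρ g) m x
  ρ-Φ* zero    g x = refl
  ρ-Φ* (suc m) g x = begin
      ρ (map (1ℚ Q.*_) g +ₚ (0ℚ ∷ (Φ m *ₚ g))) x
    ≡⟨ ρ-+ (map (1ℚ Q.*_) g) _ x ⟩
      ρ (map (1ℚ Q.*_) g) x Q.+ ρ (0ℚ ∷ (Φ m *ₚ g)) x
    ≡⟨ cong₂ Q._+_ (trans (ρ-scale 1ℚ g x) (QP.*-identityˡ (ρ g x)))
                   (trans (ρ-shift (Φ m *ₚ g) x) (ρ-Φ* m g (x Z.- 1ℤ))) ⟩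
      ρ g x Q.+ windowSum (ρ g) m (x Z.- 1ℤ)
    ≡⟨ cong₂ Q._+_ (cong (ρ g) (sym (ZP.+-identityʳ x)))
                   (sum-cong m (λ k → cong (ρ g) (sym (sub-suc x (+ k))))) ⟩
      windowSum (ρ g) (suc m) x ∎

  ≋⇒∣∸ : ∀ {m n} → + m ≋ + n → r ∣ m ∸ n
  ≋⇒∣∸ {m} {n} h with n NP.≤? m
  ... | yes n≤m = ZD.∣⇒∣ᵤ (subst (+ r ZD.∣_) (trans (ZP.m-n≡m⊖n m n) (ZP.⊖-≥ n≤m))
                                (divides-difference h))
  ... | no n≰m  = subst (r ∣_) (sym (NP.m≤n⇒m∸n≡0 (NP.≰⇒≥ n≰m))) (r ∣0)

  residues-distinct : ∀ {m n} → m < r → n < r → + m ≋ + n → m ≡ n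
  residues-distinct m<r n<r h = ∣∸-both⇒≡ m<r n<r (≋⇒∣∸ h) (≋⇒∣∸ (≋-sym h))

  multiples-distinct : ∀ {p} → Coprime r p →
    ∀ {k l} → k < r → l < r → + (k * p) ≋ + (l * p) → k ≡ l
  multiples-distinct {p} r⊥p {k} {l} k<r l<r h =
    ∣∸-both⇒≡ k<r l<r (cancel k l (≋⇒∣∸ h)) (cancel l k (≋⇒∣∸ (≋-sym h)))
    where
    cancel : ∀ u v → r ∣ u * p ∸ v * p → r ∣ u ∸ v
    cancel u v r∣ = coprime-divisor r⊥p
      (subst (r ∣_) (trans (sym (NP.*-distribʳ-∸ p u v)) (NP.*-comm (u ∸ v) p)) r∣)

  progression-bit : ∀ {p} → Coprime r p → ∀ y q → q ≤ r →
    Bit (sumBelow q (λ k → ind (y Z.- + (k * p))))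
  progression-bit {p} r⊥p y q q≤r = indicator-sum-bit (λ k → y Z.- + (k * p) ≋? 0ℤ) q once
    where
    once : AtMostOnce (λ k → y Z.- + (k * p) ≋ 0ℤ) q
    once k<q l<q hk hl = multiples-distinct r⊥p
      (NP.<-≤-trans k<q q≤r) (NP.<-≤-trans l<q q≤r) (≋-cancel-left y (≋-trans hk (≋-sym hl)))

  ≋1-from-sum : ∀ {a b c} → a + b ≡ 1 + c → r ∣ b → r ∣ c → + a ≋ 1ℤ
  ≋1-from-sum {a} {b} {c} a+b≡1+c r∣b r∣c =
    ≋-from (ZD.∣m∣n⇒∣m-n (ZD.∣ᵤ⇒∣ {i = + c} r∣c) (ZD.∣ᵤ⇒∣ {i = + b} r∣b)) (begin
      + c Z.- + b                       ≡⟨ add-sub-one (+ c) (+ b) ⟩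
      (1ℤ Z.+ + c) Z.- 1ℤ Z.- + b       ≡⟨ cong (λ w → w Z.- 1ℤ Z.- + b) (cong +_ (sym a+b≡1+c)) ⟩
      (+ a Z.+ + b) Z.- 1ℤ Z.- + b      ≡⟨ sub-add (+ a) (+ b) ⟩
      + a Z.- 1ℤ                        ∎)
    where
    add-sub-one : ∀ c b → c Z.- b ≡ (1ℤ Z.+ c) Z.- 1ℤ Z.- b
    add-sub-one = solve-∀
    sub-add : ∀ a b → (a Z.+ b) Z.- 1ℤ Z.- b ≡ a Z.- 1ℤ
    sub-add = solve-∀

  -- An inverse of p modulo r, taken in the range 0 … r, from Bézout's identity.
  inverse : ∀ {p} → .{{NonZero r}} → Coprime p r → ∃[ q ] (q ≤ r × + (q * p) ≋ 1ℤ)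
  inverse {p} p⊥r with coprime-Bézout p⊥r
  ... | Bézout.+- x y 1+yr≡xp =
    x % r , NP.<⇒≤ (m%n<n x r) , ≋1-from-sum eq (n∣m*n (x / r * p)) (n∣m*n y)
    where
    eq : x % r * p + x / r * p * r ≡ 1 + y * r
    eq = begin
      x % r * p + x / r * p * r   ≡⟨ regroup (x % r) (x / r) p r ⟩
      (x % r + x / r * r) * p     ≡⟨ cong (_* p) (sym (m≡m%n+[m/n]*n x r)) ⟩
      x * p                       ≡⟨ sym 1+yr≡xp ⟩
      1 + y * r                   ∎
      where
      regroup : ∀ q t p r → q * p + t * p * r ≡ (q + t * r) * p
      regroup = NatSolver.solve-∀
  ... | Bézout.-+ x y 1+xp≡yr =
    r ∸ x % r , NP.m∸n≤m r (x % r) ,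
    ≋1-from-sum eq (n∣m*n y) (∣m∣n⇒∣m+n (m∣m*n p) (n∣m*n (x / r * p)))
    where
    s = x % r
    t = x / r
    eq : (r ∸ s) * p + y * r ≡ 1 + (r * p + t * p * r)
    eq = begin
      (r ∸ s) * p + y * r                  ≡⟨ cong (λ w → (r ∸ s) * p + w) (sym 1+xp≡yr) ⟩
      (r ∸ s) * p + (1 + x * p)            ≡⟨ cong (λ w → (r ∸ s) * p + (1 + w * p)) (m≡m%n+[m/n]*n x r) ⟩
      (r ∸ s) * p + (1 + (s + t * r) * p)  ≡⟨ regroup (r ∸ s) s t r p ⟩
      1 + ((r ∸ s + s) * p + t * p * r)    ≡⟨ cong (λ w → 1 + (w * p + t * p * r)) (NP.m∸n+n≡m (NP.<⇒≤ (m%n<n x r))) ⟩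
      1 + (r * p + t * p * r)              ∎
      where
      regroup : ∀ q s t r p → q * p + (1 + (s + t * r) * p) ≡ 1 + ((q + s) * p + t * p * r)
      regroup = NatSolver.solve-∀

module Coefficients (p r′ : ℕ) (p-prime : Prime p) (r-prime : Prime (suc r′)) (p≢r : p ≢ suc r′)
  (U V : Poly) (deg : DegLt U r′) (bezout : Φ p *ₚ U +ₚ Φ (suc r′) *ₚ V ≈ₚ oneₚ) where

  r : ℕ
  r = suc r′

  open Modulo r

  p⊥r : Coprime p r
  p⊥r = distinct-primes-coprime p-prime r-prime p≢r

  a b : ℤ → ℚ
  a = ρ U
  b = ρ V

  reduced-bezout : ∀ x → windowSum a p x Q.+ windowSum b r x ≡ ind x
  reduced-bezout x = begin
      windowSum a p x Q.+ windowSum b r x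
    ≡⟨ sym (cong₂ Q._+_ (ρ-Φ* p U x) (ρ-Φ* r V x)) ⟩
      ρ (Φ p *ₚ U) x Q.+ ρ (Φ r *ₚ V) x
    ≡⟨ sym (ρ-+ (Φ p *ₚ U) (Φ r *ₚ V) x) ⟩
      ρ (Φ p *ₚ U +ₚ Φ r *ₚ V) x
    ≡⟨ ρ-resp (Φ p *ₚ U +ₚ Φ r *ₚ V) oneₚ bezout x ⟩
      ind x Q.* 1ℚ Q.+ 0ℚ
    ≡⟨ trans (QP.+-identityʳ _) (QP.*-identityʳ (ind x)) ⟩
      ind x ∎

  -- The Φ_r V part sums b over a full period, so it does not depend on x.
  windowSum-b-constant : ∀ x → windowSum b r x ≡ windowSum b r (x Z.- 1ℤ)
  windowSum-b-constant = windowSum-periodic b r (λ x → ρ-periodic V (≋-period x))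

  difference-equation : ∀ x → a x Q.- a (x Z.- + p) ≡ ind x Q.- ind (x Z.- 1ℤ)
  difference-equation x = begin
      a x Q.- a (x Z.- + p)
    ≡⟨ sym (windowSum-diff a p x) ⟩
      A Q.- A′
    ≡⟨ solve 3 (λ A A′ B → A :- A′ := (A :+ B) :- (A′ :+ B)) refl A A′ B′ ⟩
      (A Q.+ B′) Q.- (A′ Q.+ B′)
    ≡⟨ cong (λ w → (A Q.+ w) Q.- (A′ Q.+ B′)) (sym (windowSum-b-constant x)) ⟩
      (A Q.+ windowSum b r x) Q.- (A′ Q.+ B′)
    ≡⟨ cong₂ Q._-_ (reduced-bezout x) (reduced-bezout (x Z.- 1ℤ)) ⟩
      ind x Q.- ind (x Z.- 1ℤ) ∎
    where
    A A′ B′ : ℚ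
    A  = windowSum a p x
    A′ = windowSum a p (x Z.- 1ℤ)
    B′ = windowSum b r (x Z.- 1ℤ)

  C : ℤ → ℕ → ℚ
  C y q = sumBelow q (λ k → ind (y Z.- + (k * p)))

  telescoped : ∀ x q → a x Q.- a (x Z.- + (q * p)) ≡ C x q Q.- C (x Z.- 1ℤ) q
  telescoped x q = begin
      a x Q.- a (x Z.- + (q * p))
    ≡⟨ telescope a (λ y → ind y Q.- ind (y Z.- 1ℤ)) p difference-equation x q ⟩
      sumBelow q (λ k → ind (x Z.- + (k * p)) Q.- ind ((x Z.- + (k * p)) Z.- 1ℤ))
    ≡⟨ sum-sub q _ _ ⟩
      C x q Q.- sumBelow q (λ k → ind ((x Z.- + (k * p)) Z.- 1ℤ))
    ≡⟨ cong (λ w → C x q Q.- w) (sum-cong q (λ k → cong ind (swap x (+ (k * p))))) ⟩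
      C x q Q.- C (x Z.- 1ℤ) q ∎
    where
    swap : ∀ x s → (x Z.- s) Z.- 1ℤ ≡ (x Z.- 1ℤ) Z.- s
    swap = solve-∀

  -- Since deg U < r − 1, a n is the coefficient U_n for 0 ≤ n < r …
  a-on-residues : ∀ n → n < r → a (+ n) ≡ coeff U n
  a-on-residues n n<r = begin
      a (+ n)                       ≡⟨ ρ-one U (+ n) n others ⟩
      𝟙 (+ n ≋? + n) Q.* coeff U n  ≡⟨ cong (Q._* coeff U n) (𝟙-yes (+ n ≋? + n) ≋-refl) ⟩
      1ℚ Q.* coeff U n              ≡⟨ QP.*-identityˡ _ ⟩
      coeff U n                     ∎
    where
    others : ∀ j → j ≢ n → coeff U j ≡ 0ℚ ⊎ ¬ + n ≋ + j
    others j j≢n with r′ NP.≤? j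
    ... | yes r′≤j = inj₁ (deg j r′≤j)
    ... | no r′≰j  = inj₂ (j≢n ∘ sym ∘ residues-distinct n<r (NP.m<n⇒m<1+n (NP.≰⇒> r′≰j)))

  -- … and a (−1) = 0, because −1 ≡ r − 1 (mod r) and U_{r−1} = 0.
  a-at-minus-one : a (Z.- 1ℤ) ≡ 0ℚ
  a-at-minus-one = ρ-none U (Z.- 1ℤ) vanish
    where
    -1≋r′ : Z.- 1ℤ ≋ + r′
    -1≋r′ = ≋-from (ZD.∣m⇒∣-m (ZD.∣-refl {+ r})) (negate-suc (+ r′))
      where
      negate-suc : ∀ s → Z.- (1ℤ Z.+ s) ≡ Z.- 1ℤ Z.- s
      negate-suc = solve-∀
    vanish : ∀ j → coeff U j ≡ 0ℚ ⊎ ¬ Z.- 1ℤ ≋ + j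
    vanish j with r′ NP.≤? j
    ... | yes r′≤j = inj₁ (deg j r′≤j)
    ... | no r′≰j  = inj₂ λ h → NP.<⇒≢ (NP.≰⇒> r′≰j)
      (sym (residues-distinct (NP.n<1+n r′) (NP.m<n⇒m<1+n (NP.≰⇒> r′≰j)) (≋-trans (≋-sym -1≋r′) h)))

  coeff-as-difference : ∀ n → n < r → coeff (X-1 *ₚ U) n ≡ a (+ n Z.- 1ℤ) Q.- a (+ n)
  coeff-as-difference zero n<r = begin
      coeff (X-1 *ₚ U) 0  ≡⟨ coeff-X-1*-zero U ⟩
      0ℚ Q.- coeff U 0    ≡⟨ cong₂ Q._-_ (sym a-at-minus-one) (sym (a-on-residues 0 n<r)) ⟩
      a (Z.- 1ℤ) Q.- a (+ 0) ∎
  coeff-as-difference (suc m) n<r = begin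
      coeff (X-1 *ₚ U) (suc m)       ≡⟨ coeff-X-1*-suc U m ⟩
      coeff U m Q.- coeff U (suc m)  ≡⟨ cong₂ Q._-_ (sym (a-on-residues m (NP.<-trans (NP.n<1+n m) n<r)))
                                                    (sym (a-on-residues (suc m) n<r)) ⟩
      a (+ m) Q.- a (+ suc m)        ∎

  -- With q p ≡ 1 (mod r) and q ≤ r, the coefficient is C (n − 1) q − C n q,
  -- a difference of two numbers in {0, 1}.
  coefficient-sign : ∀ n → n < r → Sign (coeff (X-1 *ₚ U) n)
  coefficient-sign n n<r with inverse p⊥r
  ... | q , q≤r , qp≋1 =
    subst Sign (sym coefficient) (bit-difference (progression-bit r⊥p x′ q q≤r) (progression-bit r⊥p x q q≤r))
    where
    x x′ : ℤ
    x  = + n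
    x′ = x Z.- 1ℤ
    r⊥p : Coprime r p
    r⊥p = coprime-sym p⊥r
    coefficient : coeff (X-1 *ₚ U) n ≡ C x′ q Q.- C x q
    coefficient = begin
        coeff (X-1 *ₚ U) n
      ≡⟨ coeff-as-difference n n<r ⟩
        a x′ Q.- a x
      ≡⟨ cong (Q._- a x) (ρ-periodic U (≋-sub-left x (≋-sym qp≋1))) ⟩
        a (x Z.- + (q * p)) Q.- a x
      ≡⟨ solve 2 (λ u v → v :- u := :- (u :- v)) refl (a x) (a (x Z.- + (q * p))) ⟩
        Q.- (a x Q.- a (x Z.- + (q * p)))
      ≡⟨ cong Q.-_ (telescoped x q) ⟩
        Q.- (C x q Q.- C x′ q)
      ≡⟨ solve 2 (λ u v → :- (u :- v) := v :- u) refl (C x q) (C x′ q) ⟩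
        C x′ q Q.- C x q ∎

lemma2 : (p r : ℕ) → Prime p → Prime r → p ≢ r →
    (U V : Poly) → DegLt U (r ∸ 1) →
    Φ p *ₚ U +ₚ Φ r *ₚ V ≈ₚ oneₚ →
    ∀ i → 1 ≤ i → i ≤ r →
      coeff (X-1 *ₚ U) (i ∸ 1) ≡ - 1ℚ ⊎ coeff (X-1 *ₚ U) (i ∸ 1) ≡ 0ℚ ⊎ coeff (X-1 *ₚ U) (i ∸ 1) ≡ 1ℚ
lemma2 p zero     _       r-prime _   _ _ _   _      _       _    _   = contradiction r-prime ¬prime[0]
lemma2 p (suc r′) p-prime r-prime p≢r U V deg bezout (suc i) _    i<r =
  Coefficients.coefficient-sign p r′ p-prime r-prime p≢r U V deg bezout i i<r
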